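{- Let $d\ge 1$ be an integer. There is no graph $G$ with a path decomposition $(W_1,\dots,W_k)$, $2\ell$ pairwise distinct vertices $a_1,\dots,a_\ell,b_1,\dots,b_\ell$ and $\ell$ pairwise distinct indices $t_1,\dots,t_\ell\in[1,k]$, where $\ell=2d+3$, such that: (i) $a_1,\dots,a_\ell,b_1,\dots,b_\ell$ form a distance-$d$ semi-ladder in $G$; (ii) $a_i\in W_{t_i}$ for every $i\in[1,\ell]$; (iii) the bags $W_{t_1},\dots,W_{t_\ell}$ form a sunflower, i.e., there is a set $C$ with $W_{t_i}\cap W_{t_j}=C$ for all distinct $i,j\in[1,\ell]$; and (iv) the distance-$d$ profiles $\pi_d[a_1,C],\dots,\pi_d[a_\ell,C]$ in $G$ are all identical.
   Context: All graphs are finite, undirected and simple; $\mathrm{dist}_G$ is the shortest-path distance. A path decomposition of $G$ is a sequence of vertex subsets (bags) $W_1,\dots,W_k$ such that every edge has both endpoints in some bag and each vertex belongs to a contiguous set of bags. For integers $d,\ell\ge 1$, $2\ell$ pairwise distinct vertices $a_1,\dots,a_\ell,b_1,\dots,b_\ell$ form a distance-$d$ semi-ladder of order $\ell$ if $\mathrm{dist}_G(b_i,a_j)\le d$ for all $1\le i<j\le \ell$ and $\mathrm{dist}_G(b_i,a_i)>d$ for every $i$. For a vertex $v$ and a set $S$, $\pi_d[v,S]$ is the function $S\to\{0,1,\dots,d,+\infty\}$ mapping $u$ to $\mathrm{dist}_G(v,u)$ if this is at most $d$, and to $+\infty$ otherwise. -}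

module Defs where

open import Data.Nat using (ℕ; zero; suc; _≤_; _<_)
open import Data.Fin using (Fin) renaming (_<_ to _<ᶠ_; _≤_ to _≤ᶠ_)
open import Data.Fin.Subset using (Subset; _∈_; _∩_)
open import Data.Maybe using (Maybe; just; nothing)
open import Data.Product using (Σ; ∃; _×_; _,_)
open import Data.Empty using (⊥)
open import Relation.Nullary using (¬_)
open import Relation.Binary.PropositionalEquality using (_≡_; _≢_)
open import Function.Bundles using (_⇔_)

record Graph : Set₁ where
  field
    n      : ℕ
    Adj    : Fin n → Fin n → Set
    sym    : ∀ {u v} → Adj u v → Adj v u
    irrefl : ∀ {u} → ¬ Adj u u

open Graph public

data Walk (G : Graph) : Fin (n G) → Fin (n G) → ℕ → Set where
  here : ∀ {u} → Walk G u u zero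
  step : ∀ {u w v k} → Adj G u w → Walk G w v k → Walk G u v (suc k)

DistLe : (G : Graph) → Fin (n G) → Fin (n G) → ℕ → Set
DistLe G u v m = ∃ λ k → k ≤ m × Walk G u v k

Dist : (G : Graph) → Fin (n G) → Fin (n G) → ℕ → Set
Dist G u v k = Walk G u v k × (∀ j → j < k → ¬ Walk G u v j)

-- Value of the profile π_d[v,S] at u: 'just k' encodes the distance k ≤ d,
-- 'nothing' encodes +∞.  ProfileVal G d v u x  means  π_d[v,S](u) = x.
ProfileVal : (G : Graph) → ℕ → Fin (n G) → Fin (n G) → Maybe ℕ → Set
ProfileVal G d v u (just k) = Dist G v u k × k ≤ d
ProfileVal G d v u nothing  = ¬ DistLe G v u d

SameProfile : (G : Graph) → ℕ → Subset (n G) → Fin (n G) → Fin (n G) → Set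
SameProfile G d S v w =
  ∀ u → u ∈ S → ∀ x → ProfileVal G d v u x ⇔ ProfileVal G d w u x

record IsPathDecomposition (G : Graph) (k : ℕ) (W : Fin k → Subset (n G)) : Set where
  field
    cover      : ∀ v → ∃ λ t → v ∈ W t
    edges      : ∀ u v → Adj G u v → ∃ λ t → u ∈ W t × v ∈ W t
    contiguous : ∀ v (t₁ t₂ t₃ : Fin k) → t₁ ≤ᶠ t₂ → t₂ ≤ᶠ t₃ →
                 v ∈ W t₁ → v ∈ W t₃ → v ∈ W t₂

record IsSemiLadder (G : Graph) (d ℓ : ℕ) (a b : Fin ℓ → Fin (n G)) : Set where
  field
    a-inj   : ∀ i j → a i ≡ a j → i ≡ j
    b-inj   : ∀ i j → b i ≡ b j → i ≡ j
    a≢b     : ∀ i j → a i ≢ b j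
    ladder  : ∀ i j → i <ᶠ j → DistLe G (b i) (a j) d
    far     : ∀ i → ¬ DistLe G (b i) (a i) d

{-# OPTIONS --safe #-}
-- Every a_i with i ≥ 2 is within distance d of b_1, and a walk of length ≤ d
-- from b_1 to a_i avoids C: through a vertex of C, the common profile would
-- carry it over to a walk of length ≤ d from b_1 to a_1. Going from b_1 to the
-- a_i whose bag is leftmost and to the one whose bag is rightmost yields a walk
-- with at most 2d + 1 vertices, all outside C, that meets each of the 2d + 2
-- bags W_{t_i} (i ≥ 2). Two of these bags then share a vertex outside C,
-- contradicting the sunflower condition.
module Submission where

open import Defs
open import Data.Nat using (ℕ; _≤_; _+_; _*_)
open import Data.Fin using (Fin)
open import Data.Fin.Subset using (Subset; _∈_; _∩_)
open import Data.Product using (Σ; ∃; _×_)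
open import Relation.Nullary using (¬_)
open import Relation.Binary.PropositionalEquality using (_≡_; _≢_)

open import Data.Nat using (zero; suc; _<_; z≤n; s≤s)
open import Data.Nat.Induction using (<-rec)
open import Data.Nat.Properties
  using (≤-refl; ≤-trans; ≤-reflexive; <⇒≤; ≮⇒≥; m≤n+m; +-monoʳ-≤; +-mono-≤; +-comm; +-identityʳ; 1+n≰n; ≤-totalPreorder)
open import Data.Fin as Fin using (toℕ)
import Data.Fin.Properties as Finₚ
open import Data.Fin.Subset using (_∉_)
open import Data.Fin.Subset.Properties using (x∈p∩q⁺)
open import Data.List as List using (List; []; _∷_; _∷ʳ_; length)
open import Data.List.Properties using (unfold-reverse)
open import Data.List.Relation.Unary.Any as Any using (Any; here; there)
open import Data.List.Relation.Unary.Any.Properties using (lookup-index; reverse⁻)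
open import Data.List.Membership.Propositional using () renaming (_∈_ to _∈ₗ_)
open import Data.List.Membership.Propositional.Properties using (∈-lookup)
open import Data.Maybe using (just)
open import Data.Product using (_,_; ∃₂)
open import Data.Sum using (_⊎_; inj₁; inj₂; [_,_])
open import Function using (_∘_)
open import Function.Bundles using (Equivalence)
open import Relation.Binary.Bundles using (TotalPreorder)
import Relation.Binary.Construct.Flip.EqAndOrd as Flip
open import Relation.Binary.PropositionalEquality
  using (refl; cong; subst; module ≡-Reasoning) renaming (sym to ≡-sym)

module _ {c ℓ₁ ℓ₂} (O : TotalPreorder c ℓ₁ ℓ₂) where
  open TotalPreorder O using (Carrier; _≲_; total) renaming (refl to ≲-refl; trans to ≲-trans)

  argmin : ∀ {m} (f : Fin (suc m) → Carrier) → ∃ λ i → ∀ j → f i ≲ f j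
  argmin {zero}  f = Fin.zero , λ { Fin.zero → ≲-refl }
  argmin {suc m} f with argmin (f ∘ Fin.suc)
  ... | i , f-i≲ with total (f Fin.zero) (f (Fin.suc i))
  ...   | inj₁ f₀≲ = Fin.zero , λ { Fin.zero → ≲-refl ; (Fin.suc j) → ≲-trans f₀≲ (f-i≲ j) }
  ...   | inj₂ ≲f₀ = Fin.suc i , λ { Fin.zero → ≲f₀ ; (Fin.suc j) → f-i≲ j }

argmax : ∀ {c ℓ₁ ℓ₂} (O : TotalPreorder c ℓ₁ ℓ₂) (let open TotalPreorder O) →
         ∀ {m} (f : Fin (suc m) → Carrier) → ∃ λ i → ∀ j → f j ≲ f i
argmax O = argmin (Flip.totalPreorder O)

shared-witness : ∀ {A : Set} {m} (P : Fin m → A → Set) (xs : List A) →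
                 length xs < m → (∀ i → Any (P i) xs) →
                 ∃₂ λ i j → i ≢ j × ∃ λ x → x ∈ₗ xs × P i x × P j x
shared-witness P xs short hit with Finₚ.pigeonhole short (Any.index ∘ hit)
... | i , j , i<j , same-index =
  i , j , Finₚ.<⇒≢ i<j , List.lookup xs (Any.index (hit i)) , ∈-lookup _ ,
  lookup-index (hit i) ,
  subst (P j) (cong (List.lookup xs) (≡-sym same-index)) (lookup-index (hit j))

module _ {G : Graph} where

  _▷_ : ∀ {u v w k} → Walk G u v k → Adj G v w → Walk G u w (suc k)
  here     ▷ e = step e here
  step f p ▷ e = step f (p ▷ e)

  reverse : ∀ {u v k} → Walk G u v k → Walk G v u k
  reverse here       = here
  reverse (step e p) = reverse p ▷ sym G e

  _++ʷ_ : ∀ {u v w k l} → Walk G u v k → Walk G v w l → Walk G u w (k + l)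
  here     ++ʷ q = q
  step e p ++ʷ q = step e (p ++ʷ q)

  vertices : ∀ {u v k} → Walk G u v k → List (Fin (n G))
  vertices {u} here       = u ∷ []
  vertices {u} (step e p) = u ∷ vertices p

  length-vertices : ∀ {u v k} (p : Walk G u v k) → length (vertices p) ≡ suc k
  length-vertices here       = refl
  length-vertices (step e p) = cong suc (length-vertices p)

  vertices-▷ : ∀ {u v w k} (p : Walk G u v k) (e : Adj G v w) →
               vertices (p ▷ e) ≡ vertices p ∷ʳ w
  vertices-▷ here       e = refl
  vertices-▷ (step f p) e = cong (_ ∷_) (vertices-▷ p e)

  vertices-reverse : ∀ {u v k} (p : Walk G u v k) →
                     vertices (reverse p) ≡ List.reverse (vertices p)
  vertices-reverse here = refl
  vertices-reverse {u} (step e p) = begin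
    vertices (reverse p ▷ sym G e)         ≡⟨ vertices-▷ (reverse p) (sym G e) ⟩
    vertices (reverse p) ∷ʳ u              ≡⟨ cong (_∷ʳ u) (vertices-reverse p) ⟩
    List.reverse (vertices p) ∷ʳ u         ≡⟨ ≡-sym (unfold-reverse u (vertices p)) ⟩
    List.reverse (u ∷ vertices p)          ∎
    where open ≡-Reasoning

  ∈-vertices-reverse : ∀ {u v k c} (p : Walk G u v k) →
                       c ∈ₗ vertices (reverse p) → c ∈ₗ vertices p
  ∈-vertices-reverse p = reverse⁻ ∘ subst (_ ∈ₗ_) (vertices-reverse p)

  ∈-vertices-++ʷ : ∀ {u v w k l c} (p : Walk G u v k) (q : Walk G v w l) →
                   c ∈ₗ vertices (p ++ʷ q) → c ∈ₗ vertices p ⊎ c ∈ₗ vertices q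
  ∈-vertices-++ʷ here       q c∈q           = inj₂ c∈q
  ∈-vertices-++ʷ (step e p) q (here c≡u)    = inj₁ (here c≡u)
  ∈-vertices-++ʷ (step e p) q (there c∈p++q) =
    [ inj₁ ∘ there , inj₂ ] (∈-vertices-++ʷ p q c∈p++q)

  split-at-vertex : ∀ {u v k c} (p : Walk G u v k) → c ∈ₗ vertices p →
                    ∃₂ λ l m → l + m ≡ k × Walk G u c l × Walk G c v m
  split-at-vertex here       (here refl) = 0 , 0 , refl , here , here
  split-at-vertex (step e p) (here refl) = 0 , _ , refl , here , step e p
  split-at-vertex (step e p) (there c∈p) with split-at-vertex p c∈p
  ... | l , m , l+m≡k , p₁ , p₂ = suc l , m , cong suc l+m≡k , step e p₁ , p₂

  -- Adj is an arbitrary Set, so existence of a walk of given length is not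
  -- decidable and a shortest walk is only available under double negation.
  ¬¬-shortest : ∀ {u v k} → Walk G u v k → ¬ ¬ (∃ λ j → j ≤ k × Dist G u v j)
  ¬¬-shortest {u} {v} {k} = <-rec Motive shorten k
    where
    Motive : ℕ → Set
    Motive k = Walk G u v k → ¬ ¬ (∃ λ j → j ≤ k × Dist G u v j)

    shorten : ∀ k → (∀ {i} → i < k → Motive i) → Motive k
    shorten k rec p no-shortest =
      no-shortest (k , ≤-refl , p , λ i i<k q →
        rec i<k q λ (j , j≤i , dist) → no-shortest (j , ≤-trans j≤i (<⇒≤ i<k) , dist))

short-walk-avoids : ∀ {G : Graph} {d C u w b k c} → SameProfile G d C w u →
                    ¬ DistLe G b u d → (p : Walk G b w k) → k ≤ d →
                    c ∈ₗ vertices p → c ∉ C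
short-walk-avoids {G} {w = w} {c = c} same far p l+m≤d c∈p c∈C
  with split-at-vertex p c∈p
... | l , m , refl , b⇝c , c⇝w = ¬¬-shortest (reverse c⇝w) reach-u
  where
  reach-u : ¬ (∃ λ j → j ≤ m × Dist G w c j)
  reach-u (j , j≤m , dist)
    with Equivalence.to (same c c∈C (just j)) (dist , ≤-trans j≤m (≤-trans (m≤n+m m l) l+m≤d))
  ... | (u⇝c , _) , _ = far (l + j , ≤-trans (+-monoʳ-≤ l j≤m) l+m≤d , b⇝c ++ʷ reverse u⇝c)

walk-meets-bags : ∀ {G k} {W : Fin k → Subset (n G)} → IsPathDecomposition G k W →
                  ∀ {u v l} (p : Walk G u v l) {x y s} → u ∈ W x → v ∈ W y →
                  x Fin.≤ s → s Fin.≤ y → Any (_∈ W s) (vertices p)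
walk-meets-bags pd here {x} {y} {s} u∈x u∈y x≤s s≤y =
  here (IsPathDecomposition.contiguous pd _ x s y x≤s s≤y u∈x u∈y)
walk-meets-bags pd {u} (step e p) {x} {y} {s} u∈x v∈y x≤s s≤y
  with IsPathDecomposition.edges pd _ _ e
... | z , u∈z , next∈z with Finₚ.≤-total s z
...   | inj₁ s≤z = here (IsPathDecomposition.contiguous pd u x s z x≤s s≤z u∈x u∈z)
...   | inj₂ z≤s = there (walk-meets-bags pd p next∈z v∈y z≤s s≤y)

record SunflowerSemiLadder (G : Graph) (d ℓ : ℕ) : Set where
  field
    k             : ℕ
    W             : Fin k → Subset (n G)
    decomposition : IsPathDecomposition G k W
    a b           : Fin ℓ → Fin (n G)
    semi-ladder   : IsSemiLadder G d ℓ a b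
    t             : Fin ℓ → Fin k
    a∈W           : ∀ i → a i ∈ W (t i)
    C             : Subset (n G)
    sunflower     : ∀ i j → i ≢ j → W (t i) ∩ W (t j) ≡ C
    same-profile  : ∀ i j → SameProfile G d C (a i) (a j)

module _ {G d m} (S : SunflowerSemiLadder G d (suc (suc m))) where
  open SunflowerSemiLadder S
  open IsSemiLadder semi-ladder

  position : Fin (suc m) → ℕ
  position = toℕ ∘ t ∘ Fin.suc

  rung-avoids : ∀ {i l x} (p : Walk G (b Fin.zero) (a (Fin.suc i)) l) → l ≤ d →
                x ∈ₗ vertices p → x ∉ C
  rung-avoids = short-walk-avoids (same-profile _ Fin.zero) (far Fin.zero)

  rungs-bound : suc m ≤ suc (2 * d)
  rungs-bound with argmin ≤-totalPreorder position | argmax ≤-totalPreorder position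
  ... | lo , lo≤ | hi , ≤hi
    with ladder Fin.zero (Fin.suc lo) (s≤s z≤n) | ladder Fin.zero (Fin.suc hi) (s≤s z≤n)
  ... | l₁ , l₁≤d , p₁ | l₂ , l₂≤d , p₂ = ≮⇒≥ λ long →
    let i , j , i≢j , x , x∈P , x∈i , x∈j = shared-witness _ (vertices P) (short long) meets
    in avoids x∈P (subst (x ∈_) (sunflower _ _ (i≢j ∘ Finₚ.suc-injective)) (x∈p∩q⁺ (x∈i , x∈j)))
    where
    P : Walk G (a (Fin.suc lo)) (a (Fin.suc hi)) (l₁ + l₂)
    P = reverse p₁ ++ʷ p₂

    avoids : ∀ {x} → x ∈ₗ vertices P → x ∉ C
    avoids x∈P = [ rung-avoids p₁ l₁≤d ∘ ∈-vertices-reverse p₁ , rung-avoids p₂ l₂≤d ]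
                   (∈-vertices-++ʷ (reverse p₁) p₂ x∈P)

    meets : ∀ i → Any (_∈ W (t (Fin.suc i))) (vertices P)
    meets i = walk-meets-bags decomposition P (a∈W _) (a∈W _) (lo≤ i) (≤hi i)

    short : suc (2 * d) < suc m → length (vertices P) < suc m
    short long = subst (_< suc m) (≡-sym (length-vertices P)) (≤-trans (s≤s (s≤s l₁+l₂≤2d)) long)
      where
      l₁+l₂≤2d : l₁ + l₂ ≤ 2 * d
      l₁+l₂≤2d = ≤-trans (+-mono-≤ l₁≤d l₂≤d) (≤-reflexive (cong (d +_) (≡-sym (+-identityʳ d))))

order-bound : ∀ {G d ℓ} → SunflowerSemiLadder G d ℓ → ℓ ≤ 2 + 2 * d
order-bound {ℓ = zero}        _ = z≤n
order-bound {ℓ = suc zero}    _ = s≤s z≤n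
order-bound {ℓ = suc (suc m)} S = s≤s (rungs-bound S)

lemma6p10 : (d : ℕ) → 1 ≤ d →
    ¬ (Σ Graph λ G → Σ ℕ λ k → Σ (Fin k → Subset (n G)) λ W →
       Σ (Fin (2 * d + 3) → Fin (n G)) λ a → Σ (Fin (2 * d + 3) → Fin (n G)) λ b →
       Σ (Fin (2 * d + 3) → Fin k) λ t →
         IsPathDecomposition G k W
       × (∀ i j → t i ≡ t j → i ≡ j)
       × IsSemiLadder G d (2 * d + 3) a b
       × (∀ i → a i ∈ W (t i))
       × (Σ (Subset (n G)) λ C → (∀ i j → i ≢ j → W (t i) ∩ W (t j) ≡ C)
            × (∀ i j → SameProfile G d C (a i) (a j))))
lemma6p10 d _ (G , k , W , a , b , t , decomposition , _ , semi-ladder , a∈W , C , sunflower , same-profile) =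
  1+n≰n (subst (_≤ 2 + 2 * d) (+-comm (2 * d) 3) (order-bound configuration))
  where
  configuration : SunflowerSemiLadder G d (2 * d + 3)
  configuration = record
    { k = k ; W = W ; decomposition = decomposition ; a = a ; b = b
    ; semi-ladder = semi-ladder ; t = t ; a∈W = a∈W ; C = C
    ; sunflower = sunflower ; same-profile = same-profile }
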